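{- The consecutive patterns $\underline{12}$ and $\underline{21}$ are stable.
   Context: For $(k_1,\ldots,k_n)\in\mathbb N^n$, $M(k_1,\ldots,k_n)$ denotes the multiset containing the letter $j$ exactly $k_j$ times; a permutation of $M$ is a word in which each letter $j$ occurs exactly $k_j$ times. An occurrence of the consecutive pattern $\underline{12}$ (ascent; resp. $\underline{21}$, descent) in $\pi=\pi_1\cdots\pi_m$ is an index $a$ with $\pi_a<\pi_{a+1}$ (resp. $\pi_a>\pi_{a+1}$). $M^*(p;s)$ is the set of permutations of $M$ with exactly $s$ occurrences of $p$. A pattern $p$ is stable if for every $n$, every $(k_1,\ldots,k_n)\in\mathbb N^n$, every $\sigma\in\mathfrak S_n$ and every $s\in\mathbb N$, $|M(k_1,\ldots,k_n)^*(p;s)|=|M(k_{\sigma^{ -1}(1)},\ldots,k_{\sigma^{ -1}(n)})^*(p;s)|$. -}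

module Defs where

open import Data.Nat using (ℕ; zero; suc; _+_)
open import Data.Fin using (Fin; _<_; _>_)
open import Data.Fin.Properties using (_<?_; _≟_)
open import Data.Fin.Permutation using (Permutation′; _⟨$⟩ˡ_)
open import Data.List using (List; []; _∷_)
open import Data.Product using (Σ; _×_)
open import Function using (_∘_)
open import Function.Bundles using (_↔_)
open import Relation.Nullary using (does)
open import Relation.Binary.PropositionalEquality using (_≡_)
open import Data.Bool using (if_then_else_)
open import Data.List using (allFin)
open import Data.List.Relation.Unary.All using (All)

-- Letters of the alphabet {1,…,n} are represented by Fin n (order preserved).
Word : ℕ → Set
Word n = List (Fin n)

occ : ∀ {n} → Fin n → Word n → ℕ
occ j [] = 0
occ j (x ∷ w) = (if does (x ≟ j) then 1 else 0) + occ j w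

-- w is a permutation of the multiset M(k): letter j occurs exactly k j times
-- (stated as All over the finite list of letters, so that proofs are unique
-- without function extensionality)
IsPermOf : ∀ {n} → (Fin n → ℕ) → Word n → Set
IsPermOf {n} k w = All (λ j → occ j w ≡ k j) (allFin n)

-- A length-2 consecutive pattern, given by the decidable relation between
-- two adjacent letters that constitutes an occurrence.
record Pattern2 : Set₁ where
  field
    rel : ∀ {n} → Fin n → Fin n → Set
    dec : ∀ {n} (a b : Fin n) → Relation.Nullary.Dec (rel a b)

-- ascent 12 : π_a < π_{a+1};  descent 21 : π_a > π_{a+1}
asc : Pattern2
asc = record { rel = _<_ ; dec = _<?_ }

desc : Pattern2
desc = record { rel = _>_ ; dec = λ a b → b <? a }

occP : ∀ {n} → Pattern2 → Word n → ℕ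
occP p [] = 0
occP p (x ∷ []) = 0
occP p (x ∷ y ∷ w) = (if does (Pattern2.dec p x y) then 1 else 0) + occP p (y ∷ w)

MStar : ∀ {n} → (Fin n → ℕ) → Pattern2 → ℕ → Set
MStar {n} k p s = Σ (Word n) λ w → IsPermOf k w × (occP p w ≡ s)

-- Stability: for all n, k, σ, s, |M(k)^*(p;s)| = |M(k ∘ σ⁻¹)^*(p;s)|,
-- cardinality equality of these finite sets expressed as a bijection.
Stable : Pattern2 → Set
Stable p = ∀ (n : ℕ) (k : Fin n → ℕ) (σ : Permutation′ n) (s : ℕ) →
  MStar k p s ↔ MStar (k ∘ (σ ⟨$⟩ˡ_)) p s

module Submission where

-- Stability for an arbitrary permutation reduces to the swap of two adjacent letters
-- a and b = a + 1, since adjacent transpositions generate the symmetric group.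
-- For those, reverse every maximal factor of a word made of a's and b's and exchange
-- a and b inside it.  This involution turns a permutation of M(k) into one of M(k)
-- with the multiplicities of a and b exchanged.  It preserves ascents and descents:
-- a letter outside {a, b} compares in the same way with a and with b, so the pairs
-- straddling a run boundary keep their status, and inside a run an ascent ab
-- (descent ba) is mapped to an ascent ab (descent ba).

open import Defs
open import Algebra.Properties.CommutativeSemigroup using (interchange)
open import Data.Bool using (if_then_else_)
open import Data.Fin using (Fin; zero; suc; toℕ; _<_)
open import Data.Fin.Properties using (_≟_; toℕ-injective; <-irrefl)
open import Data.Fin.Permutation as Perm
  using (Permutation′; _⟨$⟩ʳ_; _∘ₚ_; _≈_; lift₀; lift₀-cong; lift₀-transpose)
open import Data.Fin.Permutation.Components using (transpose; transpose-inverse)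
open import Data.Fin.Permutation.Transposition.List as Transpositions
  using (TranspositionList; eval; decompose; eval-decompose; eval-lift)
open import Data.List using ([]; _∷_; _++_; [_]; map; reverse; length; replicate)
import Data.List.Properties as List
open import Data.List.Membership.Propositional.Properties using (∈-allFin)
open import Data.List.Relation.Unary.All as All using (All; []; _∷_)
import Data.List.Relation.Unary.All.Properties as Allₚ
import Data.List.Relation.Unary.Any.Properties as Anyₚ
open import Data.Nat as ℕ using (ℕ; suc; _+_)
import Data.Nat.Properties as ℕₚ
open import Data.Product using (_×_; _,_; proj₁; proj₂; uncurry; swap)
open import Data.Product.Function.Dependent.Propositional using (Σ-↔)
open import Data.Sum using (_⊎_; inj₁; inj₂)
open import Function using (_∘_; id; flip; _⇔_; mk⇔; _↔_; mk↔ₛ′; Equivalence; Inverse)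
open import Function.Properties.Inverse using (↔-refl; ↔-trans)
open import Relation.Binary.PropositionalEquality
  using (_≡_; _≢_; refl; sym; trans; cong; cong₂; subst; module ≡-Reasoning)
open import Relation.Nullary using (Dec; yes; no; ¬_; does; contradiction; Irrelevant)
open import Relation.Nullary.Decidable using (does-⇔; dec-false; _⊎-dec_; _×-dec_)

module _ {n : ℕ} where

  transpose-matchˡ : (i j : Fin n) → transpose i j i ≡ j
  transpose-matchˡ i j with i ≟ i
  ... | yes _ = refl
  ... | no i≢i = contradiction refl i≢i

  transpose-matchʳ : (i j : Fin n) → transpose i j j ≡ i
  transpose-matchʳ i j with j ≟ i
  ... | yes j≡i = j≡i
  ... | no _ with j ≟ j
  ...   | yes _ = refl
  ...   | no j≢j = contradiction refl j≢j

  transpose-other : {i j k : Fin n} → k ≢ i → k ≢ j → transpose i j k ≡ k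
  transpose-other {i} {j} {k} k≢i k≢j with k ≟ i
  ... | yes k≡i = contradiction k≡i k≢i
  ... | no _ with k ≟ j
  ...   | yes k≡j = contradiction k≡j k≢j
  ...   | no _ = refl

  transpose-comm : (i j k : Fin n) → transpose i j k ≡ transpose j i k
  transpose-comm i j k = by-cases (k ≟ i) (k ≟ j)
    where
    by-cases : ∀ {i j k} → Dec (k ≡ i) → Dec (k ≡ j) → transpose i j k ≡ transpose j i k
    by-cases {i} {j} (yes refl) _ = trans (transpose-matchˡ i j) (sym (transpose-matchʳ j i))
    by-cases {i} {j} (no _) (yes refl) = trans (transpose-matchʳ i j) (sym (transpose-matchˡ j i))
    by-cases (no k≢i) (no k≢j) = trans (transpose-other k≢i k≢j) (sym (transpose-other k≢j k≢i))

  transpose-involutive : (i j k : Fin n) → transpose i j (transpose i j k) ≡ k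
  transpose-involutive i j k = trans (cong (transpose i j) (transpose-comm i j k)) (transpose-inverse i j)

  transpose-self : (i k : Fin n) → transpose i i k ≡ k
  transpose-self i k = by-cases (k ≟ i)
    where
    by-cases : ∀ {i k} → Dec (k ≡ i) → transpose i i k ≡ k
    by-cases {i} (yes refl) = transpose-matchˡ i i
    by-cases (no k≢i) = transpose-other k≢i k≢i

  transpose-conjugate : {a b c : Fin n} → a ≢ b → c ≢ a → ∀ k →
                        transpose b c (transpose a b (transpose b c k)) ≡ transpose a c k
  transpose-conjugate {a} {b} {c} a≢b c≢a k = by-cases (k ≟ a) (k ≟ c) (k ≟ b)
    where
    open ≡-Reasoning
    by-cases : ∀ {k} → Dec (k ≡ a) → Dec (k ≡ c) → Dec (k ≡ b) →
               transpose b c (transpose a b (transpose b c k)) ≡ transpose a c k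
    by-cases (yes refl) _ _ = begin
      transpose b c (transpose a b (transpose b c a)) ≡⟨ cong (transpose b c ∘ transpose a b) (transpose-other a≢b (c≢a ∘ sym)) ⟩
      transpose b c (transpose a b a)                 ≡⟨ cong (transpose b c) (transpose-matchˡ a b) ⟩
      transpose b c b                                 ≡⟨ transpose-matchˡ b c ⟩
      c                                               ≡⟨ transpose-matchˡ a c ⟨
      transpose a c a                                 ∎
    by-cases (no _) (yes refl) _ = begin
      transpose b c (transpose a b (transpose b c c)) ≡⟨ cong (transpose b c ∘ transpose a b) (transpose-matchʳ b c) ⟩
      transpose b c (transpose a b b)                 ≡⟨ cong (transpose b c) (transpose-matchʳ a b) ⟩
      transpose b c a                                 ≡⟨ transpose-other a≢b (c≢a ∘ sym) ⟩
      a                                               ≡⟨ transpose-matchʳ a c ⟨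
      transpose a c c                                 ∎
    by-cases (no b≢a) (no b≢c) (yes refl) = begin
      transpose b c (transpose a b (transpose b c b)) ≡⟨ cong (transpose b c ∘ transpose a b) (transpose-matchˡ b c) ⟩
      transpose b c (transpose a b c)                 ≡⟨ cong (transpose b c) (transpose-other c≢a (b≢c ∘ sym)) ⟩
      transpose b c c                                 ≡⟨ transpose-matchʳ b c ⟩
      b                                               ≡⟨ transpose-other b≢a b≢c ⟨
      transpose a c b                                 ∎
    by-cases {k} (no k≢a) (no k≢c) (no k≢b) = begin
      transpose b c (transpose a b (transpose b c k)) ≡⟨ cong (transpose b c ∘ transpose a b) (transpose-other k≢b k≢c) ⟩
      transpose b c (transpose a b k)                 ≡⟨ cong (transpose b c) (transpose-other k≢a k≢b) ⟩
      transpose b c k                                 ≡⟨ transpose-other k≢b k≢c ⟩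
      k                                               ≡⟨ transpose-other k≢a k≢c ⟨
      transpose a c k                                 ∎

-- Products of adjacent transpositions

Adjacent : ∀ {n} → Fin n → Fin n → Set
Adjacent a b = toℕ b ≡ suc (toℕ a)

module _ {n : ℕ} where

  record IsAdjacentProduct (π : Permutation′ n) : Set where
    constructor adjacentProduct
    field
      factors  : TranspositionList n
      adjacent : All (uncurry Adjacent) factors
      eval≈    : eval factors ≈ π

  adjacentProduct-resp-≈ : ∀ {π ρ} → π ≈ ρ → IsAdjacentProduct π → IsAdjacentProduct ρ
  adjacentProduct-resp-≈ π≈ρ (adjacentProduct xs adj eval≈π) =
    adjacentProduct xs adj λ i → trans (eval≈π i) (π≈ρ i)

  adjacentProduct-id : IsAdjacentProduct Perm.id
  adjacentProduct-id = adjacentProduct [] [] λ _ → refl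

  adjacentProduct-transpose : ∀ {a b} → Adjacent a b → IsAdjacentProduct (Perm.transpose a b)
  adjacentProduct-transpose adj = adjacentProduct [ _ , _ ] (adj ∷ []) λ _ → refl

  eval-++ : ∀ (xs ys : TranspositionList n) → eval (xs ++ ys) ≈ eval xs ∘ₚ eval ys
  eval-++ [] ys i = refl
  eval-++ ((a , b) ∷ xs) ys i = eval-++ xs ys (transpose a b i)

  adjacentProduct-∘ : ∀ {π ρ} → IsAdjacentProduct π → IsAdjacentProduct ρ → IsAdjacentProduct (π ∘ₚ ρ)
  adjacentProduct-∘ {ρ = ρ} (adjacentProduct xs xs-adj xs≈π) (adjacentProduct ys ys-adj ys≈ρ) =
    adjacentProduct (xs ++ ys) (Allₚ.++⁺ xs-adj ys-adj)
      λ i → trans (eval-++ xs ys i) (trans (ys≈ρ _) (cong (ρ ⟨$⟩ʳ_) (xs≈π i)))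

adjacentProduct-lift₀ : ∀ {n} {π : Permutation′ n} → IsAdjacentProduct π → IsAdjacentProduct (lift₀ π)
adjacentProduct-lift₀ (adjacentProduct xs adj xs≈π) =
  adjacentProduct (Transpositions.lift₀ xs) (Allₚ.map⁺ (All.map (cong suc) adj))
    λ i → trans (eval-lift xs i) (lift₀-cong _ _ xs≈π i)

adjacentProduct-transpose-suc : ∀ {n} {i j : Fin n} → IsAdjacentProduct (Perm.transpose i j) →
                                IsAdjacentProduct (Perm.transpose (suc i) (suc j))
adjacentProduct-transpose-suc {i = i} {j} t =
  adjacentProduct-resp-≈ (λ k → sym (lift₀-transpose i j k)) (adjacentProduct-lift₀ t)

-- (0 j+2) is the conjugate of (0 1) by (1 j+2), a lift of the smaller transposition (0 j+1).
transpose₀-isAdjacentProduct : ∀ {n} (j : Fin (suc n)) → IsAdjacentProduct (Perm.transpose zero j)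
transpose₀-isAdjacentProduct zero = adjacentProduct-resp-≈ (λ k → sym (transpose-self zero k)) adjacentProduct-id
transpose₀-isAdjacentProduct (suc zero) = adjacentProduct-transpose refl
transpose₀-isAdjacentProduct (suc (suc j)) =
  adjacentProduct-resp-≈ (transpose-conjugate (λ ()) (λ ()))
    (adjacentProduct-∘ (adjacentProduct-∘ conjugator (adjacentProduct-transpose refl)) conjugator)
  where
  conjugator : IsAdjacentProduct (Perm.transpose (suc zero) (suc (suc j)))
  conjugator = adjacentProduct-transpose-suc (transpose₀-isAdjacentProduct (suc j))

transpose-isAdjacentProduct : ∀ {n} (i j : Fin n) → IsAdjacentProduct (Perm.transpose i j)
transpose-isAdjacentProduct zero j = transpose₀-isAdjacentProduct j
transpose-isAdjacentProduct (suc i) zero =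
  adjacentProduct-resp-≈ (transpose-comm zero (suc i)) (transpose₀-isAdjacentProduct (suc i))
transpose-isAdjacentProduct (suc i) (suc j) = adjacentProduct-transpose-suc (transpose-isAdjacentProduct i j)

permutation-isAdjacentProduct : ∀ {n} (π : Permutation′ n) → IsAdjacentProduct π
permutation-isAdjacentProduct π = adjacentProduct-resp-≈ (eval-decompose π) (product (decompose π))
  where
  product : ∀ {n} (ts : TranspositionList n) → IsAdjacentProduct (eval ts)
  product [] = adjacentProduct-id
  product ((i , j) ∷ ts) = adjacentProduct-∘ (transpose-isAdjacentProduct i j) (product ts)

δ : ∀ {n} → Fin n → Fin n → ℕ
δ x j = if does (x ≟ j) then 1 else 0

weight : ∀ {n} → Pattern2 → Fin n → Fin n → ℕ
weight p x y = if does (Pattern2.dec p x y) then 1 else 0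

module _ {n : ℕ} where

  occ-++ : ∀ j (u v : Word n) → occ j (u ++ v) ≡ occ j u + occ j v
  occ-++ j [] v = refl
  occ-++ j (x ∷ u) v = trans (cong (δ x j +_) (occ-++ j u v)) (sym (ℕₚ.+-assoc (δ x j) (occ j u) (occ j v)))

  occ-reverse : ∀ j (u : Word n) → occ j (reverse u) ≡ occ j u
  occ-reverse j [] = refl
  occ-reverse j (x ∷ u) = begin
    occ j (reverse (x ∷ u))         ≡⟨ cong (occ j) (List.unfold-reverse x u) ⟩
    occ j (reverse u ++ [ x ])      ≡⟨ occ-++ j (reverse u) [ x ] ⟩
    occ j (reverse u) + (δ x j + 0) ≡⟨ cong₂ _+_ (occ-reverse j u) (ℕₚ.+-identityʳ (δ x j)) ⟩
    occ j u + δ x j                 ≡⟨ ℕₚ.+-comm (occ j u) (δ x j) ⟩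
    occ j (x ∷ u)                   ∎
    where open ≡-Reasoning

  pairCount : (Fin n → Fin n → ℕ) → Word n → ℕ
  pairCount f [] = 0
  pairCount f (x ∷ []) = 0
  pairCount f (x ∷ y ∷ w) = f x y + pairCount f (y ∷ w)

  occP-pairCount : ∀ p (w : Word n) → occP p w ≡ pairCount (weight p) w
  occP-pairCount p [] = refl
  occP-pairCount p (x ∷ []) = refl
  occP-pairCount p (x ∷ y ∷ w) = cong (weight p x y +_) (occP-pairCount p (y ∷ w))

  module _ {f g : Fin n → Fin n → ℕ} where

    pairCount-cong : (∀ x y → f x y ≡ g x y) → ∀ w → pairCount f w ≡ pairCount g w
    pairCount-cong f≗g [] = refl
    pairCount-cong f≗g (x ∷ []) = refl
    pairCount-cong f≗g (x ∷ y ∷ w) = cong₂ _+_ (f≗g x y) (pairCount-cong f≗g (y ∷ w))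

    pairCount-+ : ∀ w → pairCount (λ x y → f x y + g x y) w ≡ pairCount f w + pairCount g w
    pairCount-+ [] = refl
    pairCount-+ (x ∷ []) = refl
    pairCount-+ (x ∷ y ∷ w) = trans (cong (f x y + g x y +_) (pairCount-+ (y ∷ w)))
      (interchange ℕₚ.+-commutativeSemigroup (f x y) (g x y) (pairCount f (y ∷ w)) (pairCount g (y ∷ w)))

  pairCount-map : ∀ f (g : Fin n → Fin n) w → pairCount f (map g w) ≡ pairCount (λ x y → f (g x) (g y)) w
  pairCount-map f g [] = refl
  pairCount-map f g (x ∷ []) = refl
  pairCount-map f g (x ∷ y ∷ w) = cong (f (g x) (g y) +_) (pairCount-map f g (y ∷ w))

  pairCount-++-∷ : ∀ f (u : Word n) y v → pairCount f (u ++ y ∷ v) ≡ pairCount f (u ++ [ y ]) + pairCount f (y ∷ v)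
  pairCount-++-∷ f [] y v = refl
  pairCount-++-∷ f (x ∷ []) y v = cong (_+ pairCount f (y ∷ v)) (sym (ℕₚ.+-identityʳ (f x y)))
  pairCount-++-∷ f (x ∷ x′ ∷ u) y v = trans (cong (f x x′ +_) (pairCount-++-∷ f (x′ ∷ u) y v))
    (sym (ℕₚ.+-assoc (f x x′) _ _))

  pairCount-reverse : ∀ f (w : Word n) → pairCount f (reverse w) ≡ pairCount (flip f) w
  pairCount-reverse f [] = refl
  pairCount-reverse f (x ∷ []) = refl
  pairCount-reverse f (x ∷ y ∷ w) = begin
    pairCount f (reverse (x ∷ y ∷ w))              ≡⟨ cong (pairCount f) reverse-unfold ⟩
    pairCount f (reverse w ++ y ∷ [ x ])           ≡⟨ pairCount-++-∷ f (reverse w) y [ x ] ⟩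
    pairCount f (reverse w ++ [ y ]) + (f y x + 0) ≡⟨ cong (pairCount f (reverse w ++ [ y ]) +_) (ℕₚ.+-identityʳ (f y x)) ⟩
    pairCount f (reverse w ++ [ y ]) + f y x       ≡⟨ cong (λ v → pairCount f v + f y x) (List.unfold-reverse y w) ⟨
    pairCount f (reverse (y ∷ w)) + f y x          ≡⟨ cong (_+ f y x) (pairCount-reverse f (y ∷ w)) ⟩
    pairCount (flip f) (y ∷ w) + f y x             ≡⟨ ℕₚ.+-comm (pairCount (flip f) (y ∷ w)) (f y x) ⟩
    pairCount (flip f) (x ∷ y ∷ w)                 ∎
    where
    open ≡-Reasoning
    reverse-unfold : reverse (x ∷ y ∷ w) ≡ reverse w ++ y ∷ [ x ]
    reverse-unfold = trans (List.unfold-reverse x (y ∷ w))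
      (trans (cong (_++ [ x ]) (List.unfold-reverse y w)) (List.++-assoc (reverse w) [ y ] [ x ]))

  pairCount-++-inert : ∀ {f x} → (∀ y → f x y ≡ 0) → (∀ y → f y x ≡ 0) →
                       ∀ (u : Word n) v → pairCount f (u ++ x ∷ v) ≡ pairCount f u + pairCount f v
  pairCount-++-inert fx0 f0x [] [] = refl
  pairCount-++-inert {f} fx0 f0x [] (y ∷ v) = cong (_+ pairCount f (y ∷ v)) (fx0 y)
  pairCount-++-inert fx0 f0x (z ∷ []) v =
    cong₂ _+_ (f0x z) (pairCount-++-inert fx0 f0x [] v)
  pairCount-++-inert {f} fx0 f0x (z ∷ z′ ∷ u) v =
    trans (cong (f z z′ +_) (pairCount-++-inert fx0 f0x (z′ ∷ u) v)) (sym (ℕₚ.+-assoc (f z z′) _ _))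

-- Flipping the {a, b}-runs of a word

module Runs {n : ℕ} (a b : Fin n) where

  IsAB : Fin n → Set
  IsAB x = x ≡ a ⊎ x ≡ b

  isAB? : ∀ x → Dec (IsAB x)
  isAB? x = x ≟ a ⊎-dec x ≟ b

  swapAB : Fin n → Fin n
  swapAB = transpose a b

  swapAB-involutive : ∀ x → swapAB (swapAB x) ≡ x
  swapAB-involutive = transpose-involutive a b

  swapAB-AB : ∀ {x} → IsAB x → IsAB (swapAB x)
  swapAB-AB (inj₁ refl) = inj₂ (transpose-matchˡ a b)
  swapAB-AB (inj₂ refl) = inj₁ (transpose-matchʳ a b)

  swapAB-AB⁻ : ∀ {x} → IsAB (swapAB x) → IsAB x
  swapAB-AB⁻ {x} = subst IsAB (swapAB-involutive x) ∘ swapAB-AB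

  swapAB-out : ∀ {x} → ¬ IsAB x → swapAB x ≡ x
  swapAB-out x∉ = transpose-other (x∉ ∘ inj₁) (x∉ ∘ inj₂)

  flipRun : Word n → Word n
  flipRun u = reverse (map swapAB u)

  flipRun-∷ : ∀ y u w → flipRun (y ∷ u) ++ w ≡ flipRun u ++ swapAB y ∷ w
  flipRun-∷ y u w = trans (cong (_++ w) (List.unfold-reverse (swapAB y) (map swapAB u)))
                          (List.++-assoc (flipRun u) [ swapAB y ] w)

  -- acc is the already flipped part of the {a, b}-run being read.
  flipRuns′ : Word n → Word n → Word n
  flipRuns′ acc [] = acc
  flipRuns′ acc (x ∷ w) with isAB? x
  ... | yes _ = flipRuns′ (swapAB x ∷ acc) w
  ... | no _ = acc ++ x ∷ flipRuns′ [] w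

  flipRuns : Word n → Word n
  flipRuns = flipRuns′ []

  -- A statistic that splits at letters outside {a, b} is computed run by run.
  module _ {A : Set} (F G : Word n → A) (_⟨_⟩_ : A → Fin n → A → A)
           (F-split : ∀ u {x} v → ¬ IsAB x → F (u ++ x ∷ v) ≡ F u ⟨ x ⟩ F v)
           (G-split : ∀ u {x} v → ¬ IsAB x → G (u ++ x ∷ v) ≡ G u ⟨ x ⟩ G v)
           (F-run : ∀ u → All IsAB u → F u ≡ G (flipRun u)) where

    flipRuns′-transport : ∀ acc w → All IsAB acc → F (flipRuns′ acc w) ≡ G (flipRun acc ++ w)
    flipRuns′-transport acc [] acc-run = trans (F-run acc acc-run) (cong G (sym (List.++-identityʳ _)))
    flipRuns′-transport acc (x ∷ w) acc-run with isAB? x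
    ... | yes x∈ = trans (flipRuns′-transport (swapAB x ∷ acc) w (swapAB-AB x∈ ∷ acc-run))
                         (cong G (trans (flipRun-∷ (swapAB x) acc w)
                                        (cong (λ y → flipRun acc ++ y ∷ w) (swapAB-involutive x))))
    ... | no x∉ = begin
      F (acc ++ x ∷ flipRuns w)  ≡⟨ F-split acc (flipRuns w) x∉ ⟩
      F acc ⟨ x ⟩ F (flipRuns w) ≡⟨ cong₂ _⟨ x ⟩_ (F-run acc acc-run) (flipRuns′-transport [] w []) ⟩
      G (flipRun acc) ⟨ x ⟩ G w  ≡⟨ G-split (flipRun acc) w x∉ ⟨
      G (flipRun acc ++ x ∷ w)   ∎
      where open ≡-Reasoning

    flipRuns-transport : ∀ w → F (flipRuns w) ≡ G w
    flipRuns-transport w = flipRuns′-transport [] w []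

  flipRuns′-++-∷ : ∀ acc u {x} v → ¬ IsAB x → flipRuns′ acc (u ++ x ∷ v) ≡ flipRuns′ acc u ++ x ∷ flipRuns v
  flipRuns′-++-∷ acc [] {x} v x∉ with isAB? x
  ... | yes x∈ = contradiction x∈ x∉
  ... | no _ = refl
  flipRuns′-++-∷ acc (y ∷ u) v x∉ with isAB? y
  ... | yes _ = flipRuns′-++-∷ (swapAB y ∷ acc) u v x∉
  ... | no _ = trans (cong (λ t → acc ++ y ∷ t) (flipRuns′-++-∷ [] u v x∉))
                     (sym (List.++-assoc acc (y ∷ flipRuns u) _))

  flipRuns′-run : ∀ acc u → All IsAB u → flipRuns′ acc u ≡ flipRun u ++ acc
  flipRuns′-run acc [] [] = refl
  flipRuns′-run acc (y ∷ u) (y∈ ∷ u-run) with isAB? y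
  ... | yes _ = trans (flipRuns′-run (swapAB y ∷ acc) u u-run) (sym (flipRun-∷ y u acc))
  ... | no y∉ = contradiction y∈ y∉

  flipRuns-involutive : ∀ w → flipRuns (flipRuns w) ≡ w
  flipRuns-involutive = flipRuns-transport flipRuns id (λ u x v → u ++ x ∷ v)
    (flipRuns′-++-∷ []) (λ _ _ _ → refl) (λ u u-run → trans (flipRuns′-run [] u u-run) (List.++-identityʳ _))

  δ-swapAB : ∀ x j → δ (swapAB x) j ≡ δ x (swapAB j)
  δ-swapAB x j = cong (λ t → if t then 1 else 0) (does-⇔ (mk⇔ to from) (swapAB x ≟ j) (x ≟ swapAB j))
    where
    to : swapAB x ≡ j → x ≡ swapAB j
    to e = trans (sym (swapAB-involutive x)) (cong swapAB e)
    from : x ≡ swapAB j → swapAB x ≡ j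
    from e = trans (cong swapAB e) (swapAB-involutive j)

  occ-map-swapAB : ∀ j u → occ j (map swapAB u) ≡ occ (swapAB j) u
  occ-map-swapAB j [] = refl
  occ-map-swapAB j (x ∷ u) = cong₂ _+_ (δ-swapAB x j) (occ-map-swapAB j u)

  occ-flipRun : ∀ j u → occ j u ≡ occ (swapAB j) (flipRun u)
  occ-flipRun j u = sym (begin
    occ (swapAB j) (reverse (map swapAB u)) ≡⟨ occ-reverse (swapAB j) (map swapAB u) ⟩
    occ (swapAB j) (map swapAB u)           ≡⟨ occ-map-swapAB (swapAB j) u ⟩
    occ (swapAB (swapAB j)) u               ≡⟨ cong (λ i → occ i u) (swapAB-involutive j) ⟩
    occ j u                                 ∎)
    where open ≡-Reasoning

  occ-flipRuns : ∀ j w → occ j (flipRuns w) ≡ occ (swapAB j) w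
  occ-flipRuns j = flipRuns-transport (occ j) (occ (swapAB j)) (λ m x k → m + (δ x j + k))
    (λ u {x} v _ → occ-++ j u (x ∷ v))
    (λ u {x} v x∉ → trans (occ-++ (swapAB j) u (x ∷ v))
       (cong (λ d → occ (swapAB j) u + (d + occ (swapAB j) v))
             (trans (sym (δ-swapAB x j)) (cong (λ y → δ y j) (swapAB-out x∉)))))
    (λ u _ → occ-flipRun j u)

  collapse : Fin n → Fin n
  collapse x with isAB? x
  ... | yes _ = a
  ... | no _ = x

  collapse-AB : ∀ {x} → IsAB x → collapse x ≡ a
  collapse-AB {x} x∈ with isAB? x
  ... | yes _ = refl
  ... | no x∉ = contradiction x∈ x∉

  collapse-out : ∀ {x} → ¬ IsAB x → collapse x ≡ x
  collapse-out {x} x∉ with isAB? x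
  ... | yes x∈ = contradiction x∈ x∉
  ... | no _ = refl

  map-collapse-run : ∀ u → All IsAB u → map collapse u ≡ replicate (length u) a
  map-collapse-run [] [] = refl
  map-collapse-run (x ∷ u) (x∈ ∷ u-run) = cong₂ _∷_ (collapse-AB x∈) (map-collapse-run u u-run)

  map-collapse-flipRun : ∀ u → All IsAB u → map collapse u ≡ map collapse (flipRun u)
  map-collapse-flipRun u u-run = begin
    map collapse u                         ≡⟨ map-collapse-run u u-run ⟩
    replicate (length u) a                 ≡⟨ cong (λ m → replicate m a) length-flipRun ⟨
    replicate (length (flipRun u)) a       ≡⟨ map-collapse-run (flipRun u) flipRun-run ⟨
    map collapse (flipRun u)               ∎
    where
    open ≡-Reasoning
    length-flipRun : length (flipRun u) ≡ length u
    length-flipRun = trans (List.length-reverse (map swapAB u)) (List.length-map swapAB u)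
    flipRun-run : All IsAB (flipRun u)
    flipRun-run = Allₚ.anti-mono Anyₚ.reverse⁻ (Allₚ.map⁺ (All.map swapAB-AB u-run))

  map-collapse-flipRuns : ∀ w → map collapse (flipRuns w) ≡ map collapse w
  map-collapse-flipRuns = flipRuns-transport (map collapse) (map collapse) (λ u x v → u ++ collapse x ∷ v)
    (λ u {x} v _ → List.map-++ collapse u (x ∷ v)) (λ u {x} v _ → List.map-++ collapse u (x ∷ v))
    map-collapse-flipRun

  pairCount-flipRun : ∀ f → (∀ x y → f (swapAB y) (swapAB x) ≡ f x y) →
                      ∀ u → pairCount f (flipRun u) ≡ pairCount f u
  pairCount-flipRun f f-sym u = begin
    pairCount f (reverse (map swapAB u))                        ≡⟨ pairCount-reverse f (map swapAB u) ⟩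
    pairCount (flip f) (map swapAB u)                           ≡⟨ pairCount-map (flip f) swapAB u ⟩
    pairCount (λ x y → f (swapAB y) (swapAB x)) u               ≡⟨ pairCount-cong f-sym u ⟩
    pairCount f u                                               ∎
    where open ≡-Reasoning

  -- Under these hypotheses f is the sum of its values on the collapsed word, which
  -- flipRuns does not change, and of runWeight, which only sees pairs inside a run.
  module _ (f : Fin n → Fin n → ℕ) (f-aa : f a a ≡ 0) (f-bb : f b b ≡ 0)
           (f-outˡ : ∀ {x} → ¬ IsAB x → f x a ≡ f x b) (f-outʳ : ∀ {x} → ¬ IsAB x → f a x ≡ f b x) where

    runWeight : Fin n → Fin n → ℕ
    runWeight x y with isAB? x | isAB? y
    ... | yes _ | yes _ = f x y
    ... | _     | _     = 0

    runWeight-in : ∀ {x y} → IsAB x → IsAB y → runWeight x y ≡ f x y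
    runWeight-in {x} {y} x∈ y∈ with isAB? x | isAB? y
    ... | yes _ | yes _ = refl
    ... | no x∉ | _     = contradiction x∈ x∉
    ... | yes _ | no y∉ = contradiction y∈ y∉

    runWeight-out : ∀ {x y} → ¬ (IsAB x × IsAB y) → runWeight x y ≡ 0
    runWeight-out {x} {y} xy∉ with isAB? x | isAB? y
    ... | yes x∈ | yes y∈ = contradiction (x∈ , y∈) xy∉
    ... | no _   | _      = refl
    ... | yes _  | no _   = refl

    f-swapAB : ∀ {x y} → IsAB x → IsAB y → f (swapAB y) (swapAB x) ≡ f x y
    f-swapAB (inj₁ refl) (inj₁ refl) =
      trans (cong₂ f (transpose-matchˡ a b) (transpose-matchˡ a b)) (trans f-bb (sym f-aa))
    f-swapAB (inj₁ refl) (inj₂ refl) = cong₂ f (transpose-matchʳ a b) (transpose-matchˡ a b)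
    f-swapAB (inj₂ refl) (inj₁ refl) = cong₂ f (transpose-matchˡ a b) (transpose-matchʳ a b)
    f-swapAB (inj₂ refl) (inj₂ refl) =
      trans (cong₂ f (transpose-matchʳ a b) (transpose-matchʳ a b)) (trans f-aa (sym f-bb))

    runWeight-swapAB : ∀ x y → runWeight (swapAB y) (swapAB x) ≡ runWeight x y
    runWeight-swapAB x y with isAB? x ×-dec isAB? y
    ... | yes (x∈ , y∈) = begin
      runWeight (swapAB y) (swapAB x) ≡⟨ runWeight-in (swapAB-AB y∈) (swapAB-AB x∈) ⟩
      f (swapAB y) (swapAB x)         ≡⟨ f-swapAB x∈ y∈ ⟩
      f x y                           ≡⟨ runWeight-in x∈ y∈ ⟨
      runWeight x y                   ∎
      where open ≡-Reasoning
    ... | no xy∉ =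
      trans (runWeight-out λ (y∈ , x∈) → xy∉ (swapAB-AB⁻ x∈ , swapAB-AB⁻ y∈)) (sym (runWeight-out xy∉))

    f-collapse : ∀ {x y} → ¬ (IsAB x × IsAB y) → f (collapse x) (collapse y) ≡ f x y
    f-collapse {x} {y} = by-cases (isAB? x) (isAB? y)
      where
      by-cases : ∀ {x y} → Dec (IsAB x) → Dec (IsAB y) → ¬ (IsAB x × IsAB y) → f (collapse x) (collapse y) ≡ f x y
      by-cases (yes x∈) (yes y∈) xy∉ = contradiction (x∈ , y∈) xy∉
      by-cases (yes (inj₁ refl)) (no y∉) _ = cong₂ f (collapse-AB (inj₁ refl)) (collapse-out y∉)
      by-cases (yes (inj₂ refl)) (no y∉) _ = trans (cong₂ f (collapse-AB (inj₂ refl)) (collapse-out y∉)) (f-outʳ y∉)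
      by-cases (no x∉) (yes (inj₁ refl)) _ = cong₂ f (collapse-out x∉) (collapse-AB (inj₁ refl))
      by-cases (no x∉) (yes (inj₂ refl)) _ = trans (cong₂ f (collapse-out x∉) (collapse-AB (inj₂ refl))) (f-outˡ x∉)
      by-cases (no x∉) (no y∉) _ = cong₂ f (collapse-out x∉) (collapse-out y∉)

    f-split : ∀ x y → f x y ≡ f (collapse x) (collapse y) + runWeight x y
    f-split x y with isAB? x ×-dec isAB? y
    ... | yes (x∈ , y∈) = sym (begin
      f (collapse x) (collapse y) + runWeight x y ≡⟨ cong₂ _+_ (cong₂ f (collapse-AB x∈) (collapse-AB y∈)) (runWeight-in x∈ y∈) ⟩
      f a a + f x y                               ≡⟨ cong (_+ f x y) f-aa ⟩
      f x y                                       ∎)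
      where open ≡-Reasoning
    ... | no xy∉ = sym (trans (cong₂ _+_ (f-collapse xy∉) (runWeight-out xy∉)) (ℕₚ.+-identityʳ (f x y)))

    pairCount-split : ∀ w → pairCount f w ≡ pairCount f (map collapse w) + pairCount runWeight w
    pairCount-split w = begin
      pairCount f w                                                        ≡⟨ pairCount-cong f-split w ⟩
      pairCount (λ x y → f (collapse x) (collapse y) + runWeight x y) w    ≡⟨ pairCount-+ w ⟩
      pairCount (λ x y → f (collapse x) (collapse y)) w + pairCount runWeight w
                                                                           ≡⟨ cong (_+ pairCount runWeight w) (pairCount-map f collapse w) ⟨
      pairCount f (map collapse w) + pairCount runWeight w                 ∎
      where open ≡-Reasoning

    pairCount-runWeight-flipRuns : ∀ w → pairCount runWeight (flipRuns w) ≡ pairCount runWeight w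
    pairCount-runWeight-flipRuns = flipRuns-transport (pairCount runWeight) (pairCount runWeight) (λ m _ k → m + k)
      split split (λ u _ → sym (pairCount-flipRun runWeight runWeight-swapAB u))
      where
      split : ∀ u {x} v → ¬ IsAB x → pairCount runWeight (u ++ x ∷ v) ≡ pairCount runWeight u + pairCount runWeight v
      split u v x∉ =
        pairCount-++-inert (λ _ → runWeight-out (x∉ ∘ proj₁)) (λ y → runWeight-out {y} (x∉ ∘ proj₂)) u v

    pairCount-flipRuns : ∀ w → pairCount f (flipRuns w) ≡ pairCount f w
    pairCount-flipRuns w = begin
      pairCount f (flipRuns w)                                             ≡⟨ pairCount-split (flipRuns w) ⟩
      pairCount f (map collapse (flipRuns w)) + pairCount runWeight (flipRuns w)
                                  ≡⟨ cong₂ _+_ (cong (pairCount f) (map-collapse-flipRuns w)) (pairCount-runWeight-flipRuns w) ⟩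
      pairCount f (map collapse w) + pairCount runWeight w                 ≡⟨ pairCount-split w ⟨
      pairCount f w                                                        ∎
      where open ≡-Reasoning

-- Patterns blind to the difference between adjacent letters

record AdjacencyBlind (p : Pattern2) : Set where
  field
    irreflexive : ∀ {n} (x : Fin n) → ¬ Pattern2.rel p x x
    blind : ∀ {n} {a b x : Fin n} → Adjacent a b → x ≢ a → x ≢ b →
            (Pattern2.rel p x a ⇔ Pattern2.rel p x b) × (Pattern2.rel p a x ⇔ Pattern2.rel p b x)

<-adjacencyBlind : ∀ {n} {a b x : Fin n} → Adjacent a b → x ≢ a → x ≢ b → (x < a ⇔ x < b) × (a < x ⇔ b < x)
<-adjacencyBlind {a = a} {b} {x} adj x≢a x≢b = mk⇔ x<a⇒x<b x<b⇒x<a , mk⇔ a<x⇒b<x b<x⇒a<x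
  where
  x<a⇒x<b : x < a → x < b
  x<a⇒x<b x<a = subst (λ m → toℕ x ℕ.< m) (sym adj) (ℕₚ.m<n⇒m<1+n x<a)
  x<b⇒x<a : x < b → x < a
  x<b⇒x<a x<b = ℕₚ.≤∧≢⇒< (ℕₚ.m<1+n⇒m≤n (subst (λ m → toℕ x ℕ.< m) adj x<b)) (x≢a ∘ toℕ-injective)
  a<x⇒b<x : a < x → b < x
  a<x⇒b<x a<x = ℕₚ.≤∧≢⇒< (subst (λ m → m ℕ.≤ toℕ x) (sym adj) a<x) (x≢b ∘ sym ∘ toℕ-injective)
  b<x⇒a<x : b < x → a < x
  b<x⇒a<x = ℕₚ.<-trans (subst (λ m → toℕ a ℕ.< m) (sym adj) (ℕₚ.n<1+n (toℕ a)))

asc-adjacencyBlind : AdjacencyBlind asc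
asc-adjacencyBlind = record { irreflexive = λ _ → <-irrefl refl ; blind = <-adjacencyBlind }

desc-adjacencyBlind : AdjacencyBlind desc
desc-adjacencyBlind = record
  { irreflexive = λ _ → <-irrefl refl
  ; blind = λ adj x≢a x≢b → swap (<-adjacencyBlind adj x≢a x≢b)
  }

occP-flipRuns : ∀ {p n} {a b : Fin n} → AdjacencyBlind p → Adjacent a b →
                ∀ w → occP p (Runs.flipRuns a b w) ≡ occP p w
occP-flipRuns {p} {a = a} {b} p-blind adj w = begin
  occP p (flipRuns w)               ≡⟨ occP-pairCount p (flipRuns w) ⟩
  pairCount (weight p) (flipRuns w) ≡⟨ pairCount-flipRuns (weight p) (irreflexive a) (irreflexive b) blindˡ blindʳ w ⟩
  pairCount (weight p) w            ≡⟨ occP-pairCount p w ⟨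
  occP p w                          ∎
  where
  open ≡-Reasoning
  open Runs a b
  open AdjacencyBlind p-blind using (blind)
  irreflexive : ∀ x → weight p x x ≡ 0
  irreflexive x = cong (λ t → if t then 1 else 0) (dec-false (Pattern2.dec p x x) (AdjacencyBlind.irreflexive p-blind x))
  blindˡ : ∀ {x} → ¬ IsAB x → weight p x a ≡ weight p x b
  blindˡ x∉ = cong (λ t → if t then 1 else 0)
    (does-⇔ (proj₁ (blind adj (x∉ ∘ inj₁) (x∉ ∘ inj₂))) (Pattern2.dec p _ a) (Pattern2.dec p _ b))
  blindʳ : ∀ {x} → ¬ IsAB x → weight p a x ≡ weight p b x
  blindʳ x∉ = cong (λ t → if t then 1 else 0)
    (does-⇔ (proj₂ (blind adj (x∉ ∘ inj₁) (x∉ ∘ inj₂))) (Pattern2.dec p a _) (Pattern2.dec p b _))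

Equinumerous : ∀ {n} → Pattern2 → (Fin n → ℕ) → (Fin n → ℕ) → Set
Equinumerous p k k′ = ∀ s → MStar k p s ↔ MStar k′ p s

irrelevant-⇔⇒↔ : ∀ {A B : Set} → Irrelevant A → Irrelevant B → A ⇔ B → A ↔ B
irrelevant-⇔⇒↔ A-irr B-irr A⇔B =
  mk↔ₛ′ (Equivalence.to A⇔B) (Equivalence.from A⇔B) (λ _ → B-irr _ _) (λ _ → A-irr _ _)

module _ {n : ℕ} {k : Fin n → ℕ} where

  isPermOf-occ : ∀ w → IsPermOf k w → ∀ j → occ j w ≡ k j
  isPermOf-occ _ w∈ j = All.lookup w∈ (∈-allFin j)

  occ-isPermOf : ∀ w → (∀ j → occ j w ≡ k j) → IsPermOf k w
  occ-isPermOf _ occ≡k = All.tabulate λ {j} _ → occ≡k j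

  isPermOf-occP-irrelevant : ∀ p w {s} → Irrelevant (IsPermOf k w × occP p w ≡ s)
  isPermOf-occP-irrelevant _ _ (w∈₁ , e₁) (w∈₂ , e₂) =
    cong₂ _,_ (All.irrelevant ℕₚ.≡-irrelevant w∈₁ w∈₂) (ℕₚ.≡-irrelevant e₁ e₂)

module _ {n : ℕ} {p : Pattern2} where

  equinumerous-via : ∀ {k k′ : Fin n → ℕ} (Φ : Word n ↔ Word n) →
                     (∀ w → occP p (Inverse.to Φ w) ≡ occP p w) →
                     (∀ w → (∀ j → occ j w ≡ k j) ⇔ (∀ j → occ j (Inverse.to Φ w) ≡ k′ j)) →
                     Equinumerous p k k′
  equinumerous-via {k} {k′} Φ occP-Φ perm-Φ s = Σ-↔ Φ λ {w} →
    irrelevant-⇔⇒↔ (isPermOf-occP-irrelevant p w) (isPermOf-occP-irrelevant p (Inverse.to Φ w)) (mk⇔ (to w) (from w))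
    where
    to : ∀ w → IsPermOf k w × occP p w ≡ s → IsPermOf k′ (Inverse.to Φ w) × occP p (Inverse.to Φ w) ≡ s
    to w (w∈ , e) = occ-isPermOf (Inverse.to Φ w) (Equivalence.to (perm-Φ w) (isPermOf-occ w w∈)) , trans (occP-Φ w) e
    from : ∀ w → IsPermOf k′ (Inverse.to Φ w) × occP p (Inverse.to Φ w) ≡ s → IsPermOf k w × occP p w ≡ s
    from w (w∈ , e) = occ-isPermOf w (Equivalence.from (perm-Φ w) (isPermOf-occ (Inverse.to Φ w) w∈))
                    , trans (sym (occP-Φ w)) e

  equinumerous-≗ : ∀ {k k′ : Fin n → ℕ} → (∀ j → k j ≡ k′ j) → Equinumerous p k k′
  equinumerous-≗ k≗k′ = equinumerous-via ↔-refl (λ _ → refl)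
    λ _ → mk⇔ (λ h j → trans (h j) (k≗k′ j)) (λ h j → trans (h j) (sym (k≗k′ j)))

  equinumerous-transpose : ∀ {k : Fin n → ℕ} {a b} → AdjacencyBlind p → Adjacent a b →
                           Equinumerous p k (k ∘ transpose a b)
  equinumerous-transpose {k} {a} {b} p-blind adj =
    equinumerous-via (mk↔ₛ′ flipRuns flipRuns flipRuns-involutive flipRuns-involutive) (occP-flipRuns p-blind adj)
      λ w → mk⇔ (λ occ≡k j → trans (occ-flipRuns j w) (occ≡k (swapAB j)))
                (λ occ≡k j → begin
                  occ j w                        ≡⟨ cong (λ i → occ i w) (swapAB-involutive j) ⟨
                  occ (swapAB (swapAB j)) w      ≡⟨ occ-flipRuns (swapAB j) w ⟨
                  occ (swapAB j) (flipRuns w)    ≡⟨ occ≡k (swapAB j) ⟩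
                  k (swapAB (swapAB j))          ≡⟨ cong k (swapAB-involutive j) ⟩
                  k j                            ∎)
    where
    open Runs a b
    open ≡-Reasoning

  equinumerous-adjacentProduct : ∀ {k : Fin n → ℕ} {π} → AdjacencyBlind p → IsAdjacentProduct π →
                                 Equinumerous p k (k ∘ (π ⟨$⟩ʳ_))
  equinumerous-adjacentProduct {k} p-blind (adjacentProduct xs adj xs≈π) s =
    ↔-trans (via-factors xs adj s) (equinumerous-≗ (cong k ∘ xs≈π) s)
    where
    via-factors : ∀ {k} xs → All (uncurry Adjacent) xs → Equinumerous p k (k ∘ (eval xs ⟨$⟩ʳ_))
    via-factors [] [] s = ↔-refl
    via-factors (_ ∷ xs) (adj ∷ xs-adj) s =
      ↔-trans (via-factors xs xs-adj s) (equinumerous-transpose p-blind adj s)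

stable : ∀ {p} → AdjacencyBlind p → Stable p
stable p-blind n k σ = equinumerous-adjacentProduct p-blind (permutation-isAdjacentProduct (Perm.flip σ))

lemma4p1 : Stable asc × Stable desc
lemma4p1 = stable asc-adjacencyBlind , stable desc-adjacencyBlind
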